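{- Let $t\geq 4$, let $r\geq\binom{t}{2}$, and let $c:E(K_r)\to\{1,\dots,r\}$ be a parallel $r$-coloring. Then there are at most $r\binom{\lfloor r/2\rfloor}{2}\binom{r-4}{t-4}$ non-rainbow copies of $K_t$ in $K_r$ under $c$.
   Context: A parallel $r$-coloring of $E(K_r)$ is a surjective map $c:E(K_r)\to\{1,\dots,r\}$ such that each color class is a matching (no two edges of the same color share a vertex). A copy of $K_t$ is rainbow if its edges receive pairwise distinct colors, and non-rainbow otherwise. -}

module Defs where

open import Data.Nat using (ℕ; zero; suc)
open import Data.Bool using (Bool; true; false)
open import Data.Fin using (Fin; _<_; _<?_; _≟_)
open import Data.Fin.Properties using (any?)
open import Data.Fin.Subset using (Subset; _∈_; ∣_∣; inside; outside)
open import Data.Fin.Subset.Properties using (_∈?_)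
open import Data.List using (List; []; _∷_; map; _++_; filter; length)
open import Data.Vec using (_∷_; [])
open import Data.Product using (_×_; _,_; ∃; ∃-syntax)
open import Data.Sum using (_⊎_)
open import Relation.Nullary using (¬_; Dec; yes; no)
open import Relation.Nullary.Decidable using (_×-dec_; _⊎-dec_; ¬?)
open import Relation.Binary.PropositionalEquality using (_≡_; _≢_)

-- An edge colouring of the complete graph K_r on vertex set Fin r with
-- colours in Fin r (colours 1..r are represented by Fin r).
-- Only the values c u v with u ≢ v are meaningful.
Colouring : ℕ → Set
Colouring r = Fin r → Fin r → Fin r

Symmetric : ∀ {r} → Colouring r → Set
Symmetric {r} c = ∀ (u v : Fin r) → u ≢ v → c u v ≡ c v u

ColourClassesMatchings : ∀ {r} → Colouring r → Set
ColourClassesMatchings {r} c =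
  ∀ (u v w : Fin r) → u ≢ v → u ≢ w → v ≢ w → c u v ≢ c u w

Surjective : ∀ {r} → Colouring r → Set
Surjective {r} c = ∀ (k : Fin r) → ∃[ u ] ∃[ v ] (u ≢ v × c u v ≡ k)

ParallelColouring : ∀ {r} → Colouring r → Set
ParallelColouring c = Symmetric c × ColourClassesMatchings c × Surjective c

allSubsets : (n : ℕ) → List (Subset n)
allSubsets zero = [] ∷ []
allSubsets (suc n) =
  map (outside ∷_) (allSubsets n) ++ map (inside ∷_) (allSubsets n)

-- the vertex sets of copies of K_t in K_r (t-element subsets of Fin r)
copiesOfK : (r t : ℕ) → List (Subset r)
copiesOfK r t = filter (λ S → ∣ S ∣ Data.Nat.≟ t) (allSubsets r)

-- a copy of K_t on vertex set S is non-rainbow: two distinct edges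
-- {a,b}, {x,y} (written with a < b, x < y) of S get the same colour
NonRainbow : ∀ {r} → Colouring r → Subset r → Set
NonRainbow {r} c S =
  ∃[ a ] ∃[ b ] ∃[ x ] ∃[ y ]
    (a < b × x < y × a ∈ S × b ∈ S × x ∈ S × y ∈ S
     × ¬ (a ≡ x × b ≡ y) × c a b ≡ c x y)

nonRainbow? : ∀ {r} (c : Colouring r) (S : Subset r) → Dec (NonRainbow c S)
nonRainbow? c S =
  any? λ a → any? λ b → any? λ x → any? λ y →
    (a <? b) ×-dec (x <? y) ×-dec (a ∈? S) ×-dec (b ∈? S) ×-dec (x ∈? S)
    ×-dec (y ∈? S) ×-dec ¬? ((a ≟ x) ×-dec (b ≟ y)) ×-dec (c a b ≟ c x y)

numNonRainbow : ∀ {r} → Colouring r → ℕ → ℕ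
numNonRainbow {r} c t = length (filter (nonRainbow? c) (copiesOfK r t))

-- A non-rainbow copy of K_t contains two distinct edges of the same colour, and since colour
-- classes are matchings these edges span four vertices. Each colour class has at most r/2 edges,
-- so there are at most r · C(r/2, 2) such 4-sets, and each of them lies in C(r-4, t-4) copies of
-- K_t; a union bound gives the claim.
module Submission where

open import Defs
open import Data.Nat using (ℕ; _≤_; _*_; _∸_; _/_)
open import Data.Nat.Combinatorics using (_C_)

open import Level using (Level)
open import Data.Nat as ℕ using (zero; suc; _+_; _<_; _≤′_; ≤′-refl; ≤′-step; z≤n; s≤s)
open import Data.Nat.Properties
open import Data.Nat.DivMod using (m*n/n≡m; /-monoˡ-≤)
open import Data.Nat.Combinatorics using (nCk+nC[k+1]≡[n+1]C[k+1]; nC1≡n)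
open import Data.Nat.ListAction using (sum)
open import Data.Fin as Fin using (Fin)
import Data.Fin.Properties as Fin
open import Data.Fin.Properties using (any?)
open import Data.Fin.Subset using (Subset; inside; outside; ⊥; ⁅_⁆; _∪_; _⊆_; ∣_∣)
  renaming (_∈_ to _∈ₛ_; _∉_ to _∉ₛ_)
open import Data.Fin.Subset.Properties
  using (_⊆?_; drop-∷-⊆; p⊆q⇒∣p∣≤∣q∣; ∣p∣≤n; ∣⊥∣≡0; ∉⊥; x∈p∪q⁻; x∈⁅y⁆⇒x≡y; ∪-identityˡ)
open import Data.Vec as Vec using (_∷_; here; there)
open import Data.List using (List; []; _∷_; map; _++_; filter; length; allFin; concatMap)
open import Data.List.Properties
  using (length-++; length-map; length-tabulate; filter-++; filter-none; filter-accept; length-filter)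
open import Data.List.Membership.Propositional using (_∈_)
open import Data.List.Membership.Propositional.Properties
  using (∈-filter⁺; ∈-filter⁻; ∈-map⁺; ∈-map⁻; ∈-++⁺ˡ; ∈-++⁺ʳ; ∈-++⁻; ∈-allFin; ∈-concat⁺′; ∈-concatMap⁻)
open import Data.List.Relation.Unary.Any using (here; there; satisfied)
open import Data.List.Relation.Unary.All as All using (All; []; _∷_)
open import Data.List.Relation.Unary.All.Properties using () renaming (map⁺ to All-map⁺)
open import Data.List.Relation.Unary.AllPairs using ([]; _∷_)
open import Data.List.Relation.Unary.Unique.Propositional using (Unique)
open import Data.List.Relation.Unary.Unique.Propositional.Properties using (allFin⁺; ++⁺)
import Data.List.Relation.Unary.Unique.Propositional.Properties as Unique
import Data.List.Relation.Binary.Sublist.Propositional.Properties as Sublist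
open import Data.List.Relation.Binary.Sublist.Propositional using (_∷ʳ_; ⊆-refl)
import Data.Product as Product
open import Data.Product using (_×_; _,_; proj₂; ∃-syntax)
open import Data.Sum using (_⊎_; inj₁; inj₂)
open import Function using (_∘_; case_of_)
open import Relation.Nullary using (¬_; yes; no; contradiction)
open import Relation.Nullary.Decidable using (_×-dec_)
open import Relation.Unary using (Pred; Decidable)
open import Relation.Binary.PropositionalEquality
  using (_≡_; _≢_; refl; sym; trans; cong; cong₂; subst; ≢-sym; module ≡-Reasoning)

private
  variable
    a b ℓ ℓ′ : Level
    A : Set a
    B : Set b
    n : ℕ

module _ {P : Pred A ℓ} (P? : Decidable P) where

  length-filter-mono : {Q : Pred A ℓ′} (Q? : Decidable Q) → (∀ {x} → P x → Q x) →
                       ∀ xs → length (filter P? xs) ≤ length (filter Q? xs)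
  length-filter-mono Q? P⇒Q xs =
    Sublist.length-mono-≤ (Sublist.filter⁺ P? Q? (λ { refl → P⇒Q }) (⊆-refl {x = xs}))

  length-filter-∷ : ∀ {x} xs → length (filter P? xs) ≤ length (filter P? (x ∷ xs))
  length-filter-∷ {x} xs =
    Sublist.length-mono-≤ (Sublist.filter⁺ P? P? (λ { refl → λ px → px }) (x ∷ʳ ⊆-refl))

  length-filter-none : (∀ {x} → ¬ P x) → ∀ xs → length (filter P? xs) ≡ 0
  length-filter-none ¬P xs = cong length (filter-none P? (All.universal (λ _ → ¬P) xs))

  length-filter-map : (f : B → A) → ∀ xs → length (filter P? (map f xs)) ≡ length (filter (P? ∘ f) xs)
  length-filter-map f [] = refl
  length-filter-map f (x ∷ xs) with P? (f x)
  ... | yes _ = cong suc (length-filter-map f xs)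
  ... | no _ = length-filter-map f xs

  filter-filter : {Q : Pred A ℓ′} (Q? : Decidable Q) →
                  ∀ xs → filter P? (filter Q? xs) ≡ filter (λ x → Q? x ×-dec P? x) xs
  filter-filter Q? [] = refl
  filter-filter Q? (x ∷ xs) with Q? x
  ... | no _ = filter-filter Q? xs
  ... | yes _ with P? x
  ...   | yes _ = cong (x ∷_) (filter-filter Q? xs)
  ...   | no _ = filter-filter Q? xs

module _ {f g : B → ℕ} (f≤g : ∀ w → f w ≤ g w) where

  sum-map-mono : ∀ ws → sum (map f ws) ≤ sum (map g ws)
  sum-map-mono [] = z≤n
  sum-map-mono (w ∷ ws) = +-mono-≤ (f≤g w) (sum-map-mono ws)

  sum-map-mono-< : ∀ {w ws} → w ∈ ws → f w < g w → sum (map f ws) < sum (map g ws)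
  sum-map-mono-< {ws = _ ∷ ws} (here refl) fw<gw = +-mono-<-≤ fw<gw (sum-map-mono ws)
  sum-map-mono-< {ws = v ∷ _} (there w∈ws) fw<gw = +-mono-≤-< (f≤g v) (sum-map-mono-< w∈ws fw<gw)

sum-map-≤-length* : {f : B → ℕ} {d : ℕ} → ∀ ws → (∀ {w} → w ∈ ws → f w ≤ d) →
                    sum (map f ws) ≤ length ws * d
sum-map-≤-length* [] _ = z≤n
sum-map-≤-length* (w ∷ ws) bound = +-mono-≤ (bound (here refl)) (sum-map-≤-length* ws (bound ∘ there))

length-concatMap : (f : A → List B) → ∀ xs → length (concatMap f xs) ≡ sum (map (length ∘ f) xs)
length-concatMap f [] = refl
length-concatMap f (x ∷ xs) = trans (length-++ (f x)) (cong (length (f x) +_) (length-concatMap f xs))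

length-filter-≤-sum : {P : Pred A ℓ} (P? : Decidable P) {ws : List B} {Q : B → Pred A ℓ′}
                      (Q? : ∀ w → Decidable (Q w)) → (∀ {x} → P x → ∃[ w ] (w ∈ ws × Q w x)) →
                      ∀ xs → length (filter P? xs) ≤ sum (map (λ w → length (filter (Q? w) xs)) ws)
length-filter-≤-sum P? Q? cover [] = z≤n
length-filter-≤-sum P? {ws} Q? cover (x ∷ xs) with P? x
... | no _ = ≤-trans (length-filter-≤-sum P? Q? cover xs) (sum-map-mono (λ w → length-filter-∷ (Q? w) xs) ws)
... | yes px with cover px
...   | w , w∈ws , qwx = ≤-trans (s≤s (length-filter-≤-sum P? Q? cover xs))
        (sum-map-mono-< (λ w → length-filter-∷ (Q? w) xs) w∈ws
          (≤-reflexive (sym (cong length (filter-accept (Q? w) qwx)))))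

Unique-map⁺ : {f : A → B} {xs : List A} → (∀ {x y} → x ∈ xs → y ∈ xs → f x ≡ f y → x ≡ y) →
              Unique xs → Unique (map f xs)
Unique-map⁺ {xs = []} _ [] = []
Unique-map⁺ {f = f} {xs = x ∷ xs} inj (x∉xs ∷ xs!) =
  All-map⁺ (All.tabulate fx≢fy) ∷ Unique-map⁺ (λ u v → inj (there u) (there v)) xs!
  where
  fx≢fy : ∀ {y} → y ∈ xs → f x ≢ f y
  fx≢fy y∈xs fx≡fy = All.lookup x∉xs y∈xs (inj (here refl) (there y∈xs) fx≡fy)

pairs : List A → List (A × A)
pairs [] = []
pairs (x ∷ xs) = map (x ,_) xs ++ pairs xs

length-pairs : ∀ (xs : List A) → length (pairs xs) ≡ length xs C 2
length-pairs [] = refl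
length-pairs (x ∷ xs) = begin
  length (map (x ,_) xs ++ pairs xs)  ≡⟨ length-++ (map (x ,_) xs) ⟩
  length (map (x ,_) xs) + length (pairs xs)  ≡⟨ cong₂ _+_ (length-map (x ,_) xs) (length-pairs xs) ⟩
  length xs + length xs C 2  ≡⟨ cong (_+ length xs C 2) (sym (nC1≡n (length xs))) ⟩
  length xs C 1 + length xs C 2  ≡⟨ nCk+nC[k+1]≡[n+1]C[k+1] (length xs) 1 ⟩
  suc (length xs) C 2  ∎
  where open ≡-Reasoning

∈-pairs⁺ : ∀ {u v} {xs : List A} → u ∈ xs → v ∈ xs → u ≢ v → (u , v) ∈ pairs xs ⊎ (v , u) ∈ pairs xs
∈-pairs⁺ (here refl) (here refl) u≢v = contradiction refl u≢v
∈-pairs⁺ {xs = x ∷ _} (here refl) (there v∈xs) _ = inj₁ (∈-++⁺ˡ (∈-map⁺ (x ,_) v∈xs))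
∈-pairs⁺ {xs = x ∷ _} (there u∈xs) (here refl) _ = inj₂ (∈-++⁺ˡ (∈-map⁺ (x ,_) u∈xs))
∈-pairs⁺ {xs = x ∷ xs} (there u∈xs) (there v∈xs) u≢v with ∈-pairs⁺ u∈xs v∈xs u≢v
... | inj₁ uv∈ = inj₁ (∈-++⁺ʳ (map (x ,_) xs) uv∈)
... | inj₂ vu∈ = inj₂ (∈-++⁺ʳ (map (x ,_) xs) vu∈)

∈-pairs⁻ : ∀ {u v} {xs : List A} → (u , v) ∈ pairs xs → u ∈ xs × v ∈ xs
∈-pairs⁻ {xs = x ∷ xs} uv∈ with ∈-++⁻ (map (x ,_) xs) uv∈
... | inj₁ uv∈map with ∈-map⁻ (x ,_) uv∈map
...   | _ , v∈xs , refl = here refl , there v∈xs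
∈-pairs⁻ _ | inj₂ uv∈pairs = Product.map there there (∈-pairs⁻ uv∈pairs)

∈-pairs⇒≢ : ∀ {u v} {xs : List A} → Unique xs → (u , v) ∈ pairs xs → u ≢ v
∈-pairs⇒≢ {xs = x ∷ xs} (x∉xs ∷ xs!) uv∈ with ∈-++⁻ (map (x ,_) xs) uv∈
... | inj₁ uv∈map with ∈-map⁻ (x ,_) uv∈map
...   | _ , v∈xs , refl = All.lookup x∉xs v∈xs
∈-pairs⇒≢ (_ ∷ xs!) _ | inj₂ uv∈pairs = ∈-pairs⇒≢ xs! uv∈pairs

C-suc : ∀ n k → n C k ≤ suc n C k
C-suc n zero = ≤-refl
C-suc n (suc k) = ≤-trans (m≤n+m (n C suc k) (n C k)) (≤-reflexive (nCk+nC[k+1]≡[n+1]C[k+1] n k))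

C-monoˡ-≤ : ∀ {m n} k → m ≤ n → m C k ≤ n C k
C-monoˡ-≤ {m} k m≤n = go (≤⇒≤′ m≤n)
  where
  go : ∀ {n} → m ≤′ n → m C k ≤ n C k
  go ≤′-refl = ≤-refl
  go (≤′-step m≤′n) = ≤-trans (go m≤′n) (C-suc _ k)

fromList : List (Fin n) → Subset n
fromList [] = ⊥
fromList (x ∷ xs) = ⁅ x ⁆ ∪ fromList xs

∣⁅x⁆∪p∣≡1+∣p∣ : ∀ (x : Fin n) (p : Subset n) → x ∉ₛ p → ∣ ⁅ x ⁆ ∪ p ∣ ≡ suc ∣ p ∣
∣⁅x⁆∪p∣≡1+∣p∣ Fin.zero (inside ∷ p) x∉p = contradiction here x∉p
∣⁅x⁆∪p∣≡1+∣p∣ Fin.zero (outside ∷ p) _ = cong (suc ∘ ∣_∣) (∪-identityˡ p)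
∣⁅x⁆∪p∣≡1+∣p∣ (Fin.suc x) (inside ∷ p) x∉p = cong suc (∣⁅x⁆∪p∣≡1+∣p∣ x p (x∉p ∘ there))
∣⁅x⁆∪p∣≡1+∣p∣ (Fin.suc x) (outside ∷ p) x∉p = ∣⁅x⁆∪p∣≡1+∣p∣ x p (x∉p ∘ there)

∈-fromList⁻ : ∀ {x : Fin n} {xs} → x ∈ₛ fromList xs → x ∈ xs
∈-fromList⁻ {xs = []} x∈ = contradiction x∈ ∉⊥
∈-fromList⁻ {xs = y ∷ ys} x∈ with x∈p∪q⁻ ⁅ y ⁆ (fromList ys) x∈
... | inj₁ x∈⁅y⁆ = here (x∈⁅y⁆⇒x≡y y x∈⁅y⁆)
... | inj₂ x∈ys = there (∈-fromList⁻ x∈ys)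

fromList-⊆ : ∀ {xs} {S : Subset n} → All (_∈ₛ S) xs → fromList xs ⊆ S
fromList-⊆ xs⊆S x∈ = All.lookup xs⊆S (∈-fromList⁻ x∈)

∣fromList∣ : ∀ {xs : List (Fin n)} → Unique xs → ∣ fromList xs ∣ ≡ length xs
∣fromList∣ {n = n} [] = ∣⊥∣≡0 n
∣fromList∣ {xs = x ∷ xs} (x∉xs ∷ xs!) =
  trans (∣⁅x⁆∪p∣≡1+∣p∣ x (fromList xs) (λ x∈ → All.lookup x∉xs (∈-fromList⁻ x∈) refl))
        (cong suc (∣fromList∣ xs!))

Unique⇒length≤ : ∀ {xs : List (Fin n)} → Unique xs → length xs ≤ n
Unique⇒length≤ {xs = xs} xs! = subst (_≤ _) (∣fromList∣ xs!) (∣p∣≤n (fromList xs))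

length-filter-allSubsets : {P : Pred (Subset (suc n)) ℓ} (P? : Decidable P) →
  length (filter P? (allSubsets (suc n))) ≡
  length (filter (P? ∘ (outside ∷_)) (allSubsets n)) + length (filter (P? ∘ (inside ∷_)) (allSubsets n))
length-filter-allSubsets {n = n} P? = begin
  length (filter P? (map (outside ∷_) Ss ++ map (inside ∷_) Ss))
    ≡⟨ cong length (filter-++ P? (map (outside ∷_) Ss) _) ⟩
  length (filter P? (map (outside ∷_) Ss) ++ filter P? (map (inside ∷_) Ss))
    ≡⟨ length-++ (filter P? (map (outside ∷_) Ss)) ⟩
  length (filter P? (map (outside ∷_) Ss)) + length (filter P? (map (inside ∷_) Ss))
    ≡⟨ cong₂ _+_ (length-filter-map P? (outside ∷_) Ss) (length-filter-map P? (inside ∷_) Ss) ⟩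
  length (filter (P? ∘ (outside ∷_)) Ss) + length (filter (P? ∘ (inside ∷_)) Ss)  ∎
  where
  open ≡-Reasoning
  Ss = allSubsets n

SupersetOfSize : Subset n → ℕ → Pred (Subset n) _
SupersetOfSize F m S = ∣ S ∣ ≡ m × F ⊆ S

supersetOfSize? : (F : Subset n) (m : ℕ) → Decidable (SupersetOfSize F m)
supersetOfSize? F m S = (∣ S ∣ ℕ.≟ m) ×-dec (F ⊆? S)

count-supersets : ∀ (F : Subset n) k →
  length (filter (supersetOfSize? F (∣ F ∣ + k)) (allSubsets n)) ≤ (n ∸ ∣ F ∣) C k
count-supersets Vec.[] zero = length-filter (supersetOfSize? Vec.[] 0) (Vec.[] ∷ [])
count-supersets Vec.[] (suc k) with supersetOfSize? Vec.[] (suc k) Vec.[]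
... | no _ = z≤n
... | yes (() , _)
count-supersets {suc n} (inside ∷ F) k =
  ≤-trans (≤-reflexive (length-filter-allSubsets P?)) (+-mono-≤ (≤-reflexive avoiding-0) containing-0)
  where
  P? = supersetOfSize? (inside ∷ F) (∣ inside ∷ F ∣ + k)
  avoiding-0 : length (filter (P? ∘ (outside ∷_)) (allSubsets n)) ≡ 0
  avoiding-0 = length-filter-none (P? ∘ (outside ∷_)) (λ { (_ , F⊆S) → case F⊆S here of λ () }) (allSubsets n)
  containing-0 : length (filter (P? ∘ (inside ∷_)) (allSubsets n)) ≤ (n ∸ ∣ F ∣) C k
  containing-0 = ≤-trans (length-filter-mono (P? ∘ (inside ∷_)) (supersetOfSize? F (∣ F ∣ + k))
                      (λ (∣S∣ , F⊆S) → suc-injective ∣S∣ , drop-∷-⊆ F⊆S) (allSubsets n))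
                   (count-supersets F k)
count-supersets {suc n} (outside ∷ F) zero =
  ≤-trans (≤-reflexive (length-filter-allSubsets P?)) (+-mono-≤ avoiding-0 (≤-reflexive containing-0))
  where
  P? = supersetOfSize? (outside ∷ F) (∣ F ∣ + 0)
  avoiding-0 : length (filter (P? ∘ (outside ∷_)) (allSubsets n)) ≤ (n ∸ ∣ F ∣) C 0
  avoiding-0 = ≤-trans (length-filter-mono (P? ∘ (outside ∷_)) (supersetOfSize? F (∣ F ∣ + 0))
                         (λ (∣S∣ , F⊆S) → ∣S∣ , drop-∷-⊆ F⊆S) (allSubsets n))
                      (count-supersets F 0)
  containing-0 : length (filter (P? ∘ (inside ∷_)) (allSubsets n)) ≡ 0
  containing-0 = length-filter-none (P? ∘ (inside ∷_)) too-small (allSubsets n)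
    where
    too-small : ∀ {S} → ¬ SupersetOfSize (outside ∷ F) (∣ F ∣ + 0) (inside ∷ S)
    too-small {S} (∣S∣ , F⊆S) =
      1+n≰n (subst (_≤ ∣ S ∣) (sym (trans ∣S∣ (+-identityʳ _))) (p⊆q⇒∣p∣≤∣q∣ (drop-∷-⊆ F⊆S)))
count-supersets {suc n} (outside ∷ F) (suc k) = begin
  length (filter P? (allSubsets (suc n)))
    ≤⟨ ≤-trans (≤-reflexive (length-filter-allSubsets P?)) (+-mono-≤ avoiding-0 containing-0) ⟩
  m C suc k + m C k  ≡⟨ +-comm (m C suc k) (m C k) ⟩
  m C k + m C suc k  ≡⟨ nCk+nC[k+1]≡[n+1]C[k+1] m k ⟩
  suc m C suc k      ≡⟨ cong (_C suc k) (sym (+-∸-assoc 1 (∣p∣≤n F))) ⟩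
  (suc n ∸ ∣ F ∣) C suc k  ∎
  where
  open ≤-Reasoning
  m = n ∸ ∣ F ∣
  P? = supersetOfSize? (outside ∷ F) (∣ F ∣ + suc k)
  avoiding-0 : length (filter (P? ∘ (outside ∷_)) (allSubsets n)) ≤ m C suc k
  avoiding-0 = ≤-trans (length-filter-mono (P? ∘ (outside ∷_)) (supersetOfSize? F (∣ F ∣ + suc k))
                         (λ (∣S∣ , F⊆S) → ∣S∣ , drop-∷-⊆ F⊆S) (allSubsets n))
                      (count-supersets F (suc k))
  containing-0 : length (filter (P? ∘ (inside ∷_)) (allSubsets n)) ≤ m C k
  containing-0 = ≤-trans (length-filter-mono (P? ∘ (inside ∷_)) (supersetOfSize? F (∣ F ∣ + k))
                      (λ (∣S∣ , F⊆S) → suc-injective (trans ∣S∣ (+-suc _ k)) , drop-∷-⊆ F⊆S) (allSubsets n))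
                   (count-supersets F k)

count-copiesOfK-⊇ : ∀ {r t m} (F : Subset r) → ∣ F ∣ ≡ m → m ≤ t →
  length (filter (F ⊆?_) (copiesOfK r t)) ≤ (r ∸ m) C (t ∸ m)
count-copiesOfK-⊇ {r} {t} F refl ∣F∣≤t = begin
  length (filter (F ⊆?_) (filter (λ S → ∣ S ∣ ℕ.≟ t) (allSubsets r)))
    ≡⟨ cong length (filter-filter (F ⊆?_) (λ S → ∣ S ∣ ℕ.≟ t) (allSubsets r)) ⟩
  length (filter (supersetOfSize? F t) (allSubsets r))
    ≡⟨ cong (λ m → length (filter (supersetOfSize? F m) (allSubsets r))) (sym (m+[n∸m]≡n ∣F∣≤t)) ⟩
  length (filter (supersetOfSize? F (∣ F ∣ + (t ∸ ∣ F ∣))) (allSubsets r))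
    ≤⟨ count-supersets F (t ∸ ∣ F ∣) ⟩
  (r ∸ ∣ F ∣) C (t ∸ ∣ F ∣)  ∎
  where open ≤-Reasoning

module ProperColouring {r} (c : Colouring r) (symmetric : Symmetric c) (matching : ColourClassesMatchings c) where

  colour-injectiveʳ : ∀ {u v w} → u ≢ v → u ≢ w → c u v ≡ c u w → v ≡ w
  colour-injectiveʳ {u} {v} {w} u≢v u≢w uv≡uw with v Fin.≟ w
  ... | yes v≡w = v≡w
  ... | no v≢w = contradiction uv≡uw (matching u v w u≢v u≢w v≢w)

  colour-sym-< : ∀ {u v} → u Fin.< v → c v u ≡ c u v
  colour-sym-< u<v = symmetric _ _ (≢-sym (Fin.<⇒≢ u<v))

  sameColour⇒Unique : ∀ {a b x y} → a Fin.< b → x Fin.< y → a ≢ x → c a b ≡ c x y →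
                      Unique (a ∷ b ∷ x ∷ y ∷ [])
  sameColour⇒Unique {a} {b} {x} {y} a<b x<y a≢x ab≡xy =
    (a≢b ∷ a≢x ∷ a≢y ∷ []) ∷ (b≢x ∷ b≢y ∷ []) ∷ (x≢y ∷ []) ∷ [] ∷ []
    where
    a≢b = Fin.<⇒≢ a<b
    x≢y = Fin.<⇒≢ x<y
    a≢y : a ≢ y
    a≢y refl = Fin.<⇒≢ (Fin.<-trans x<y a<b)
      (sym (colour-injectiveʳ a≢b (≢-sym x≢y) (trans ab≡xy (sym (colour-sym-< x<y)))))
    b≢x : b ≢ x
    b≢x refl = Fin.<⇒≢ (Fin.<-trans a<b x<y)
      (colour-injectiveʳ (≢-sym a≢b) x≢y (trans (colour-sym-< a<b) ab≡xy))
    b≢y : b ≢ y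
    b≢y refl = a≢x (colour-injectiveʳ (≢-sym a≢b) (≢-sym x≢y)
      (trans (colour-sym-< a<b) (trans ab≡xy (sym (colour-sym-< x<y)))))

  LowerEnd : Fin r → Pred (Fin r) _
  LowerEnd k a = ∃[ b ] (a Fin.< b × c a b ≡ k)

  lowerEnd? : ∀ k → Decidable (LowerEnd k)
  lowerEnd? k a = any? (λ b → (a Fin.<? b) ×-dec (c a b Fin.≟ k))

  lowerEnds : Fin r → List (Fin r)
  lowerEnds k = filter (lowerEnd? k) (allFin r)

  ∈-lowerEnds⁻ : ∀ {k a} → a ∈ lowerEnds k → LowerEnd k a
  ∈-lowerEnds⁻ {k} a∈ = proj₂ (∈-filter⁻ (lowerEnd? k) {xs = allFin r} a∈)

  lowerEnds-Unique : ∀ k → Unique (lowerEnds k)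
  lowerEnds-Unique k = Unique.filter⁺ (lowerEnd? k) (allFin⁺ r)

  -- junk (a itself) when a is not a lower end
  partner : Fin r → Fin r → Fin r
  partner k a with lowerEnd? k a
  ... | yes (b , _) = b
  ... | no _ = a

  partner-lowerEnd : ∀ {k a} → LowerEnd k a → a Fin.< partner k a × c a (partner k a) ≡ k
  partner-lowerEnd {k} {a} end with lowerEnd? k a
  ... | yes (_ , spec) = spec
  ... | no ¬end = contradiction end ¬end

  partner-unique : ∀ {k a b} → a Fin.< b → c a b ≡ k → partner k a ≡ b
  partner-unique a<b ab≡k with partner-lowerEnd (_ , a<b , ab≡k)
  ... | a<p , ap≡k = colour-injectiveʳ (Fin.<⇒≢ a<p) (Fin.<⇒≢ a<b) (trans ap≡k (sym ab≡k))

  partner-injective : ∀ {k x y} → LowerEnd k x → LowerEnd k y → partner k x ≡ partner k y → x ≡ y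
  partner-injective {k} {x} {y} end-x end-y px≡py
    with partner-lowerEnd end-x | partner-lowerEnd end-y
  ... | x<p , xp≡k | y<py , ypy≡k rewrite sym px≡py =
    colour-injectiveʳ (≢-sym (Fin.<⇒≢ x<p)) (≢-sym (Fin.<⇒≢ y<py))
      (trans (colour-sym-< x<p) (trans xp≡k (sym (trans (colour-sym-< y<py) ypy≡k))))

  partner-not-lowerEnd : ∀ {k a} → LowerEnd k a → ¬ LowerEnd k (partner k a)
  partner-not-lowerEnd end-a end-p with partner-lowerEnd end-a | partner-lowerEnd end-p
  ... | a<p , ap≡k | p<q , pq≡k =
    Fin.<⇒≢ (Fin.<-trans a<p p<q) (colour-injectiveʳ (≢-sym (Fin.<⇒≢ a<p)) (Fin.<⇒≢ p<q)
      (trans (colour-sym-< a<p) (trans ap≡k (sym pq≡k))))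

  -- The lower ends of colour k together with their partners are 2 · |lowerEnds k| distinct vertices.
  length-lowerEnds : ∀ k → length (lowerEnds k) ≤ r / 2
  length-lowerEnds k = subst (_≤ r / 2) (m*n/n≡m (length L) 2)
    (/-monoˡ-≤ 2 (subst (_≤ r) length-endpoints (Unique⇒length≤ endpoints-Unique)))
    where
    L = lowerEnds k
    endpoints-Unique : Unique (L ++ map (partner k) L)
    endpoints-Unique = ++⁺ (lowerEnds-Unique k)
      (Unique-map⁺ (λ x∈ y∈ → partner-injective (∈-lowerEnds⁻ x∈) (∈-lowerEnds⁻ y∈)) (lowerEnds-Unique k))
      λ (v∈L , v∈pL) → case ∈-map⁻ (partner k) v∈pL of λ where
        (a , a∈L , refl) → partner-not-lowerEnd (∈-lowerEnds⁻ a∈L) (∈-lowerEnds⁻ v∈L)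
    length-endpoints : length (L ++ map (partner k) L) ≡ length L * 2
    length-endpoints = begin
      length (L ++ map (partner k) L)        ≡⟨ length-++ L ⟩
      length L + length (map (partner k) L)  ≡⟨ cong (length L +_) (length-map (partner k) L) ⟩
      length L + length L                    ≡⟨ cong (length L +_) (sym (+-identityʳ _)) ⟩
      2 * length L                           ≡⟨ *-comm 2 (length L) ⟩
      length L * 2                           ∎
      where open ≡-Reasoning

  edgePairSet : Fin r → Fin r × Fin r → Subset r
  edgePairSet k (a , x) = fromList (a ∷ partner k a ∷ x ∷ partner k x ∷ [])

  edgePairSetsOfColour : Fin r → List (Subset r)
  edgePairSetsOfColour k = map (edgePairSet k) (pairs (lowerEnds k))

  sameColourEdgePairs : List (Subset r)
  sameColourEdgePairs = concatMap edgePairSetsOfColour (allFin r)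

  length-sameColourEdgePairs : length sameColourEdgePairs ≤ r * ((r / 2) C 2)
  length-sameColourEdgePairs = begin
    length sameColourEdgePairs
      ≡⟨ length-concatMap edgePairSetsOfColour (allFin r) ⟩
    sum (map (length ∘ edgePairSetsOfColour) (allFin r))
      ≤⟨ sum-map-≤-length* (allFin r) (λ {k} _ → pairs-of-colour k) ⟩
    length (allFin r) * ((r / 2) C 2)
      ≡⟨ cong (_* ((r / 2) C 2)) (length-tabulate {n = r} (λ k → k)) ⟩
    r * ((r / 2) C 2)  ∎
    where
    open ≤-Reasoning
    pairs-of-colour : ∀ k → length (edgePairSetsOfColour k) ≤ (r / 2) C 2
    pairs-of-colour k = begin
      length (edgePairSetsOfColour k)  ≡⟨ length-map (edgePairSet k) (pairs (lowerEnds k)) ⟩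
      length (pairs (lowerEnds k))  ≡⟨ length-pairs (lowerEnds k) ⟩
      length (lowerEnds k) C 2  ≤⟨ C-monoˡ-≤ 2 (length-lowerEnds k) ⟩
      (r / 2) C 2  ∎

  ∣sameColourEdgePair∣≡4 : ∀ {F} → F ∈ sameColourEdgePairs → ∣ F ∣ ≡ 4
  ∣sameColourEdgePair∣≡4 F∈ with satisfied (∈-concatMap⁻ edgePairSetsOfColour {xs = allFin r} F∈)
  ... | k , F∈k with ∈-map⁻ (edgePairSet k) F∈k
  ...   | (a , x) , ax∈ , refl with ∈-pairs⁻ ax∈
  ...     | a∈L , x∈L with partner-lowerEnd (∈-lowerEnds⁻ a∈L) | partner-lowerEnd (∈-lowerEnds⁻ x∈L)
  ...       | a<pa , apa≡k | x<px , xpx≡k =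
    ∣fromList∣ (sameColour⇒Unique a<pa x<px (∈-pairs⇒≢ (lowerEnds-Unique k) ax∈) (trans apa≡k (sym xpx≡k)))

  nonRainbow⇒⊇sameColourEdgePair : ∀ {S} → NonRainbow c S → ∃[ F ] (F ∈ sameColourEdgePairs × F ⊆ S)
  nonRainbow⇒⊇sameColourEdgePair {S} (a , b , x , y , a<b , x<y , a∈S , b∈S , x∈S , y∈S , distinct , ab≡xy) =
    contained (∈-pairs⁺ a∈L x∈L a≢x)
    where
    k = c a b
    pa≡b : partner k a ≡ b
    pa≡b = partner-unique a<b refl
    px≡y : partner k x ≡ y
    px≡y = partner-unique x<y (sym ab≡xy)
    a≢x : a ≢ x
    a≢x a≡x = distinct (a≡x , trans (sym pa≡b) (trans (cong (partner k) a≡x) px≡y))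
    a∈L : a ∈ lowerEnds k
    a∈L = ∈-filter⁺ (lowerEnd? k) (∈-allFin a) (b , a<b , refl)
    x∈L : x ∈ lowerEnds k
    x∈L = ∈-filter⁺ (lowerEnd? k) (∈-allFin x) (y , x<y , sym ab≡xy)
    pa∈S : partner k a ∈ₛ S
    pa∈S = subst (_∈ₛ S) (sym pa≡b) b∈S
    px∈S : partner k x ∈ₛ S
    px∈S = subst (_∈ₛ S) (sym px≡y) y∈S
    listed : ∀ {p} → p ∈ pairs (lowerEnds k) → edgePairSet k p ∈ sameColourEdgePairs
    listed p∈ = ∈-concat⁺′ (∈-map⁺ (edgePairSet k) p∈) (∈-map⁺ edgePairSetsOfColour (∈-allFin k))
    contained : (a , x) ∈ pairs (lowerEnds k) ⊎ (x , a) ∈ pairs (lowerEnds k) →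
                ∃[ F ] (F ∈ sameColourEdgePairs × F ⊆ S)
    contained (inj₁ ax∈) = edgePairSet k (a , x) , listed ax∈ , fromList-⊆ (a∈S ∷ pa∈S ∷ x∈S ∷ px∈S ∷ [])
    contained (inj₂ xa∈) = edgePairSet k (x , a) , listed xa∈ , fromList-⊆ (x∈S ∷ px∈S ∷ a∈S ∷ pa∈S ∷ [])

lemma7 : (t r : ℕ) → 4 ≤ t → t C 2 ≤ r → (c : Colouring r) → ParallelColouring c
    → numNonRainbow c t ≤ r * ((r / 2) C 2) * ((r ∸ 4) C (t ∸ 4))
lemma7 t r 4≤t _ c (symmetric , matching , _) = begin
  numNonRainbow c t
    ≤⟨ length-filter-≤-sum (nonRainbow? c) (λ F → F ⊆?_) nonRainbow⇒⊇sameColourEdgePair (copiesOfK r t) ⟩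
  sum (map (λ F → length (filter (F ⊆?_) (copiesOfK r t))) sameColourEdgePairs)
    ≤⟨ sum-map-≤-length* sameColourEdgePairs (λ {F} F∈ → count-copiesOfK-⊇ F (∣sameColourEdgePair∣≡4 F∈) 4≤t) ⟩
  length sameColourEdgePairs * ((r ∸ 4) C (t ∸ 4))
    ≤⟨ *-monoˡ-≤ ((r ∸ 4) C (t ∸ 4)) length-sameColourEdgePairs ⟩
  r * ((r / 2) C 2) * ((r ∸ 4) C (t ∸ 4))  ∎
  where
  open ≤-Reasoning
  open ProperColouring c symmetric matching
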